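{- Let $k \geq 2$ be a power of $2$, let $(\mathcal{N}, \mathcal{I})$ be a $k$-extendible system with weights that are all integer powers of $k$ and lie in $[w_{\min}, w_{\max}]$ for given positive $w_{\min}, w_{\max}$, and let $\rho$ be the maximum size of an independent set. The Greedy of Greedies algorithm can be implemented using space $O(\rho (\log(w_{\max}/w_{\min})/\log k + 1))$, assuming constant space suffices to store a single element and a single weight.
   Context: Greedy of Greedies: let $i_{\min} = \lceil \log_k w_{\min} \rceil$ and $i_{\max} = \lfloor \log_k w_{\max} \rfloor$, and create instances $\mathrm{Greedy}_{i_{\min}}, \dots, \mathrm{Greedy}_{i_{\max}}$ of the unweighted greedy algorithm (which starts with the empty set and adds each element it is fed to its current solution unless this makes the solution not independent). Each arriving element $u$, with $i_u = \log_k w(u)$, is fed to $\mathrm{Greedy}_{i_{\min}}, \dots, \mathrm{Greedy}_{i_u}$. After the stream ends, let $C_i$ be the output of $\mathrm{Greedy}_i$; set $T = \varnothing$ and, for $i = i_{\max}, i_{\max}-1, \dots, i_{\min}$, greedily add elements of $C_i$ to $T$ as long as $T$ stays independent; return $T$. The data stream model: elements arrive one by one in adversarial order, each weight revealed on arrival, with access to an independence oracle. A $k$-extendible system is an independence system (finite ground set, non-empty down-closed family of independent sets) such that for any $S \subseteq T \subseteq \mathcal{N}$ and $u \notin T$ with $S \cup \{u\} \in \mathcal{I}$ there is $Y \subseteq T \setminus S$, $|Y| \leq k$, with $(T \setminus Y) \cup \{u\} \in \mathcal{I}$. -}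

module Defs where

open import Data.Nat using (ℕ; suc; _+_; _*_; _≤_; _≤?_)
open import Data.Integer using (ℤ; _-_) renaming (∣_∣ to absℤ; _≤_ to _≤ℤ_)
open import Data.Fin using (Fin; toℕ)
open import Data.Fin.Subset using (Subset; _⊆_; _∪_; _─_; ⁅_⁆; ⊥; ∣_∣; _∉_)
open import Data.Fin.Subset.Properties using (_∈?_)
open import Data.List as List using (List; []; _∷_; _++_; scanl; filter; allFin; concatMap; reverse; foldl)
open import Data.Nat.ListAction using (sum)
open import Data.Vec as Vec using (Vec; tabulate; lookup; replicate; toList)
open import Data.Product using (Σ; ∃-syntax; _×_; _,_)
open import Data.Bool using (if_then_else_)
open import Relation.Nullary using (Dec; does)
open import Relation.Binary.PropositionalEquality using (_≡_)

record IsIndependenceSystem {n : ℕ} (Ind : Subset n → Set) : Set where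
  field
    nonEmpty   : ∃[ S ] Ind S
    downClosed : ∀ {S T} → S ⊆ T → Ind T → Ind S

record IsKExtendible (k : ℕ) {n : ℕ} (Ind : Subset n → Set) : Set where
  field
    isIndependenceSystem : IsIndependenceSystem Ind
    extendible : ∀ (S T : Subset n) (u : Fin n) → S ⊆ T → u ∉ T →
                 Ind (S ∪ ⁅ u ⁆) →
                 ∃[ Y ] (Y ⊆ (T ─ S) × ∣ Y ∣ ≤ k × Ind ((T ─ Y) ∪ ⁅ u ⁆))

IsMaxIndepSize : {n : ℕ} → (Subset n → Set) → ℕ → Set
IsMaxIndepSize {n} Ind ρ =
  (∃[ S ] (Ind S × ∣ S ∣ ≡ ρ)) × (∀ (S : Subset n) → Ind S → ∣ S ∣ ≤ ρ)

-- Weights: w(u) = k ^ e(u) with integer exponent e(u) ∈ [imin, imax].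
-- Instance Greedy_{imin + j} is stored at position j ∈ {0,…,D},
-- D = |imax - imin|; element u is fed to positions j ≤ |e(u) - imin|.

module GreedyOfGreedies {n : ℕ} {Ind : Subset n → Set}
                        (ind? : ∀ S → Dec (Ind S))
                        (imin imax : ℤ) (e : Fin n → ℤ) where

  D : ℕ
  D = absℤ (imax - imin)

  level : Fin n → ℕ
  level u = absℤ (e u - imin)

  greedyAdd : Subset n → Fin n → Subset n
  greedyAdd S u = if does (ind? (S ∪ ⁅ u ⁆)) then S ∪ ⁅ u ⁆ else S

  Cs : Set
  Cs = Vec (Subset n) (suc D)

  initial : Cs
  initial = replicate (suc D) ⊥

  step : Cs → Fin n → Cs
  step C u = tabulate λ j →
    if does (toℕ j ≤? level u) then greedyAdd (lookup C j) u else lookup C j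

  phase1 : List (Fin n) → List Cs
  phase1 stream = scanl step initial stream

  final : List (Fin n) → Cs
  final stream = foldl step initial stream

  members : Subset n → List (Fin n)
  members S = filter (λ u → u ∈? S) (allFin n)

  postOrder : Cs → List (Fin n)
  postOrder C = concatMap (λ j → members (lookup C j)) (reverse (allFin (suc D)))

  phase2 : List (Fin n) → List (Subset n)
  phase2 stream = scanl greedyAdd ⊥ (postOrder (final stream))

  output : List (Fin n) → Subset n
  output stream = foldl greedyAdd ⊥ (postOrder (final stream))

  Config : Set
  Config = Cs × Subset n

  -- space: number of stored elements (each element / weight costs O(1))
  space : Config → ℕ
  space (C , T) = sum (toList (Vec.map ∣_∣ C)) + ∣ T ∣

  trace : List (Fin n) → List Config
  trace stream = List.map (λ C → C , ⊥) (phase1 stream)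
              ++ List.map (λ T → final stream , T) (phase2 stream)

module Submission where

-- Every set the algorithm ever stores is independent: the instances
-- Greedy_i start from the empty set, which is independent in any
-- independence system, and an unweighted greedy step only adds an element
-- when the result stays independent; the post-processing set T is built the
-- same way.  Hence each of the D + 1 stored solutions C_i and the set T has
-- at most ρ elements, so every memory configuration stores at most
-- (D + 1)·ρ + ρ ≤ 2·ρ·(D + 1) elements.

open import Defs
open import Data.Nat using (ℕ; suc; _*_; _^_; _≤_; _≤?_; _+_; NonZero)
open import Data.Nat.Properties using (≤-refl; ≤-reflexive; +-mono-≤; m≤m*n; *-comm; +-identityʳ; module ≤-Reasoning)
open import Data.Nat.ListAction using (sum)
open import Data.Integer using (ℤ) renaming (_≤_ to _≤ℤ_)
open import Data.Fin using (Fin; zero; suc; toℕ)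
open import Data.Fin.Subset using (Subset; ⊥; ∣_∣; _∪_; ⁅_⁆)
open import Data.Fin.Subset.Properties using (⊥⊆)
open import Data.List using (List; []; _∷_; scanl; foldl)
open import Data.List.Relation.Unary.All using (All; []; _∷_)
import Data.List.Relation.Unary.All as All
open import Data.List.Relation.Unary.All.Properties using (++⁺; map⁺)
open import Data.Vec as Vec using (Vec; lookup; toList)
open import Data.Vec.Properties using (lookup∘tabulate; lookup-replicate)
open import Data.Product using (∃-syntax; _×_; _,_; proj₂)
open import Data.Bool using (Bool; true; false; if_then_else_)
open import Relation.Nullary using (Dec; yes; no; does)
open import Relation.Binary.PropositionalEquality using (_≡_; cong; subst; sym)

if-preserves : ∀ {A : Set} (P : A → Set) (b : Bool) {x y : A} →
  P x → P y → P (if b then x else y)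
if-preserves P true  px _  = px
if-preserves P false _  py = py

scanl-invariant : ∀ {A B : Set} (P : A → Set) (f : A → B → A) →
  (∀ a b → P a → P (f a b)) → ∀ a xs → P a → All P (scanl f a xs)
scanl-invariant P f pres a []       pa = pa ∷ []
scanl-invariant P f pres a (x ∷ xs) pa =
  pa ∷ scanl-invariant P f pres (f a x) xs (pres a x pa)

foldl-invariant : ∀ {A B : Set} (P : A → Set) (f : A → B → A) →
  (∀ a b → P a → P (f a b)) → ∀ a xs → P a → P (foldl f a xs)
foldl-invariant P f pres a []       pa = pa
foldl-invariant P f pres a (x ∷ xs) pa =
  foldl-invariant P f pres (f a x) xs (pres a x pa)

sum-map-bound : ∀ {A : Set} {m b : ℕ} (f : A → ℕ) (v : Vec A m) →
  (∀ j → f (lookup v j) ≤ b) → sum (toList (Vec.map f v)) ≤ m * b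
sum-map-bound f Vec.[]       bounded = ≤-refl
sum-map-bound f (x Vec.∷ v) bounded =
  +-mono-≤ (bounded zero) (sum-map-bound f v (λ j → bounded (suc j)))

slots-plus-one : ∀ m ρ .{{_ : NonZero m}} → m * ρ + ρ ≤ 2 * (ρ * m)
slots-plus-one m ρ = begin
  m * ρ + ρ            ≤⟨ +-mono-≤ (≤-reflexive (*-comm m ρ)) (m≤m*n ρ m) ⟩
  ρ * m + ρ * m        ≡⟨ cong (ρ * m +_) (sym (+-identityʳ (ρ * m))) ⟩
  2 * (ρ * m)          ∎
  where open ≤-Reasoning

module GreedyInvariant {n : ℕ} {Ind : Subset n → Set}
                       (ind? : ∀ S → Dec (Ind S))
                       (indSys : IsIndependenceSystem Ind)
                       (imin imax : ℤ) (e : Fin n → ℤ) where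

  open GreedyOfGreedies ind? imin imax e
  open IsIndependenceSystem indSys

  empty-independent : Ind ⊥
  empty-independent = downClosed ⊥⊆ (proj₂ nonEmpty)

  greedyAdd-independent : ∀ S u → Ind S → Ind (greedyAdd S u)
  greedyAdd-independent S u indS with ind? (S ∪ ⁅ u ⁆)
  ... | yes indS∪u = indS∪u
  ... | no  _      = indS

  AllIndependent : Cs → Set
  AllIndependent C = ∀ j → Ind (lookup C j)

  initial-independent : AllIndependent initial
  initial-independent j = subst Ind (sym (lookup-replicate j ⊥)) empty-independent

  feed : Cs → Fin n → Fin (suc D) → Subset n
  feed C u j =
    if does (toℕ j ≤? level u) then greedyAdd (lookup C j) u else lookup C j

  step-independent : ∀ C u → AllIndependent C → AllIndependent (step C u)
  step-independent C u indC j =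
    subst Ind (sym (lookup∘tabulate (feed C u) j))
      (if-preserves Ind (does (toℕ j ≤? level u))
        (greedyAdd-independent (lookup C j) u (indC j)) (indC j))

  final-independent : ∀ stream → AllIndependent (final stream)
  final-independent stream =
    foldl-invariant AllIndependent step step-independent initial stream initial-independent

  ConfigIndependent : Config → Set
  ConfigIndependent (C , T) = AllIndependent C × Ind T

  trace-independent : ∀ stream → All ConfigIndependent (trace stream)
  trace-independent stream = ++⁺
    (map⁺ (All.map (λ indC → indC , empty-independent) streaming))
    (map⁺ (All.map (λ indT → final-independent stream , indT) postProcessing))
    where
    streaming : All AllIndependent (phase1 stream)
    streaming = scanl-invariant AllIndependent step step-independent
                  initial stream initial-independent
    postProcessing : All Ind (phase2 stream)
    postProcessing = scanl-invariant Ind greedyAdd greedyAdd-independent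
                       ⊥ (postOrder (final stream)) empty-independent

  space-bound : ∀ ρ → (∀ S → Ind S → ∣ S ∣ ≤ ρ) →
    ∀ cfg → ConfigIndependent cfg → space cfg ≤ 2 * (ρ * suc D)
  space-bound ρ maxSize (C , T) (indC , indT) = begin
    space (C , T)    ≤⟨ +-mono-≤ (sum-map-bound ∣_∣ C (λ j → maxSize _ (indC j)))
                                (maxSize T indT) ⟩
    suc D * ρ + ρ    ≤⟨ slots-plus-one (suc D) ρ ⟩
    2 * (ρ * suc D)  ∎
    where open ≤-Reasoning

-- Lemma 4.4: the run uses space O(ρ·(log(w_max/w_min)/log k + 1)),
-- where D + 1 = i_max − i_min + 1 is the number of greedy instances.
lemma4p4 : ∃[ c ] ∀ (k : ℕ) → 2 ≤ k → (∃[ m ] k ≡ 2 ^ m) →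
    ∀ (n : ℕ) (Ind : Subset n → Set) (ind? : ∀ S → Dec (Ind S)) →
    IsKExtendible k Ind →
    ∀ (ρ : ℕ) → IsMaxIndepSize Ind ρ →
    ∀ (imin imax : ℤ) (e : Fin n → ℤ) → (∀ u → imin ≤ℤ e u × e u ≤ℤ imax) →
    ∀ (stream : List (Fin n)) →
    All (λ cfg → GreedyOfGreedies.space ind? imin imax e cfg
                   ≤ c * (ρ * suc (GreedyOfGreedies.D ind? imin imax e)))
        (GreedyOfGreedies.trace ind? imin imax e stream)
lemma4p4 = 2 , λ _ _ _ _ _ ind? ext ρ (_ , maxSize) imin imax e _ stream →
  let open GreedyInvariant ind? (IsKExtendible.isIndependenceSystem ext) imin imax e
  in All.map (λ {cfg} → space-bound ρ maxSize cfg) (trace-independent stream)
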